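{- For the Edge Dominating Set$(k)$ problem, any (randomized) streaming algorithm needs $\Omega(n)$ space, where $n$ is the number of vertices of the input graph.
   Context: Edge Dominating Set$(k)$: given an undirected graph $G=(V,E)$ and an integer $k$, decide whether there is a set $X\subseteq E$ with $|X|\le k$ such that every edge in $E\setminus X$ shares an endpoint with some edge of $X$. The graph is given as a stream of edges and the algorithm makes a single pass; a randomized algorithm must be correct with constant probability bounded above $1/2$. Space is measured in bits. -}

module Defs where

open import Data.Nat using (ℕ; suc; _+_; _*_; _^_; _≤_; _<_)
open import Data.Fin using (Fin; toℕ)
open import Data.Bool using (Bool; true)
open import Data.List using (List; foldl; length)
open import Data.List.Relation.Unary.All using (All)
open import Data.List.Relation.Unary.Any using (Any)
open import Data.List.Relation.Unary.Unique.Propositional using (Unique)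
open import Data.List.Membership.Propositional using (_∈_)
open import Data.Product using (Σ; ∃; _×_; _,_; proj₁; proj₂)
open import Data.Sum using (_⊎_)
open import Relation.Binary.PropositionalEquality using (_≡_)
open import Function.Bundles using (_⇔_)
import Data.Fin.Subset as S

-- An (undirected, loopless) edge on vertex set Fin n, stored canonically as
-- (u , v) with u < v.
Edge : ℕ → Set
Edge n = Σ (Fin n × Fin n) (λ uv → toℕ (proj₁ uv) < toℕ (proj₂ uv))

src tgt : ∀ {n} → Edge n → Fin n
src e = proj₁ (proj₁ e)
tgt e = proj₂ (proj₁ e)

Adjacent : ∀ {n} → Edge n → Edge n → Set
Adjacent e f = (src e ≡ src f) ⊎ (src e ≡ tgt f) ⊎ (tgt e ≡ src f) ⊎ (tgt e ≡ tgt f)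

IsEDS : ∀ {n} → List (Edge n) → List (Edge n) → Set
IsEDS E X = All (_∈ E) X × All (λ e → e ∈ X ⊎ Any (Adjacent e) X) E

HasEDS : ∀ {n} → List (Edge n) → ℕ → Set
HasEDS E k = ∃ λ (X : List _) → Unique X × length X ≤ k × IsEDS E X

-- A randomized one-pass streaming algorithm on n-vertex graphs using s bits
-- of memory: the memory content is an element of Fin (2 ^ s). The random seed
-- is drawn uniformly from Fin (suc seeds) (public coins, fixed before the
-- stream). The parameter k is known to the algorithm.
record StreamAlg (n s : ℕ) : Set where
  field
    seeds : ℕ
    init  : Fin (suc seeds) → ℕ → Fin (2 ^ s)
    step  : Fin (suc seeds) → ℕ → Fin (2 ^ s) → Edge n → Fin (2 ^ s)
    out   : Fin (suc seeds) → ℕ → Fin (2 ^ s) → Bool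

  run : Fin (suc seeds) → ℕ → List (Edge n) → Fin (2 ^ s)
  run r k stream = foldl (step r k) (init r k) stream

open StreamAlg public

CorrectOn : ∀ {n s} (A : StreamAlg n s) → Fin (suc (seeds A)) → ℕ → List (Edge n) → Set
CorrectOn A r k stream = (out A r k (run A r k stream) ≡ true) ⇔ HasEDS stream k

-- A solves Edge Dominating Set(k) with success probability at least a / b:
-- for every k and every edge stream (each edge appearing once, in any order),
-- the set of seeds on which A is correct has probability ≥ a / b.
SolvesEDS : ∀ {n s} → ℕ → ℕ → StreamAlg n s → Set
SolvesEDS a b A = ∀ (k : ℕ) (stream : List (Edge _)) → Unique stream →
  ∃ λ (G : S.Subset (suc (seeds A))) →
    (a * suc (seeds A) ≤ b * S.∣ G ∣) × (∀ r → r S.∈ G → CorrectOn A r k stream)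

-- Edge Dominating Set(1) embeds the one-way Index problem: Alice's bits x ∈ {0,1}^m become spokes
-- hub — item j, Bob's index i becomes the edge probe — item i, and a single edge dominates the graph
-- iff x i = 1, so the memory after Alice's edges is an s-bit message. Averaging over the random seed
-- fixes one seed whose answers agree with x on a fraction a / b > 1/2 of all pairs (x, i). Weight
-- each x by u ^ (#agreements) * v ^ (#disagreements) with a fixed string, u = V + 1, v = V − 1: the
-- weights sum to (2 V) ^ m, so by Markov's inequality each of the 2 ^ s messages decodes correctly
-- beyond a threshold fraction T / L ∈ (1/2, a / b) only on a set of small weight. For m = L q this
-- forces 2 ^ q ≤ b L 2 ^ s, hence s = Ω(m) = Ω(n).
module Submission where

open import Defs
open import Data.Nat using (ℕ; zero; suc; _+_; _*_; _^_; _∸_; _≤_; _<_; z≤n; s≤s; NonZero; _≤?_; _<?_)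
open import Data.Nat.Properties
open import Data.Nat.DivMod using (_/_; _%_; m≡m%n+[m/n]*n; m%n<n)
open import Data.Nat.ListAction using (sum)
open import Data.Nat.ListAction.Properties using (sum-++)
open import Data.Nat.Tactic.RingSolver using (solve-∀)
open import Data.Fin using (Fin; zero; suc; _↑ʳ_)
open import Data.Fin.Properties using (↑ʳ-injective) renaming (suc-injective to fsuc-injective)
open import Data.Fin.Subset as Subset using (Subset; ∣_∣; inside; outside)
open import Data.Vec using (Vec; []; _∷_; lookup; here; there)
open import Data.Bool using (Bool; true; false; not)
open import Data.Bool.Properties using (⇔→≡) renaming (_≟_ to _≟ᵇ_)
open import Data.List using (List; []; _∷_; _++_; [_]; map; filter; length; allFin; tabulate)
open import Data.List.Properties using (map-cong; map-++; map-∘; map-tabulate; length-++; length-map; length-tabulate; foldl-++)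
open import Data.List.Relation.Unary.All using ([]; _∷_) renaming (lookup to All-lookup; tabulate to All-tabulate)
open import Data.List.Relation.Unary.Any using (Any; here; there)
open import Data.List.Relation.Unary.Any.Properties using (singleton⁻)
open import Data.List.Relation.Unary.AllPairs using ([]; _∷_)
open import Data.List.Relation.Unary.Unique.Propositional using (Unique)
open import Data.List.Relation.Unary.Unique.Propositional.Properties as Unique using (allFin⁺)
open import Data.List.Membership.Propositional using (_∈_)
open import Data.List.Membership.Propositional.Properties using (∈-map⁺; ∈-map⁻; ∈-filter⁺; ∈-filter⁻; ∈-allFin; ∈-++⁺ˡ; ∈-++⁺ʳ; ∈-++⁻)
open import Data.Product using (∃; ∃₂; _×_; _,_)
open import Data.Sum using (_⊎_; inj₁; inj₂)
import Data.Sum as Sum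
open import Data.Empty using (⊥-elim)
open import Function using (_∘_; id)
open import Function.Bundles using (_⇔_; mk⇔)
import Function.Properties.Equivalence as ⇔
open import Relation.Binary.PropositionalEquality using (_≡_; _≢_; refl; sym; trans; cong; cong₂; subst; subst₂; module ≡-Reasoning)
open import Relation.Nullary using (¬_; Dec; yes; no)
open import Algebra.Properties.CommutativeSemigroup +-commutativeSemigroup using (interchange)
open import Algebra.Properties.CommutativeSemigroup *-commutativeSemigroup using () renaming (interchange to *-interchange)

-- Finite sums over lists

private variable
  A B : Set

∑ : List A → (A → ℕ) → ℕ
∑ xs f = sum (map f xs)

syntax ∑ xs (λ x → e) = ∑[ x ← xs ] e

∑-cong : ∀ (xs : List A) {f g : A → ℕ} → (∀ x → f x ≡ g x) → ∑ xs f ≡ ∑ xs g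
∑-cong xs f≗g = cong sum (map-cong f≗g xs)

∑-mono-≤ : ∀ (xs : List A) {f g : A → ℕ} → (∀ x → f x ≤ g x) → ∑ xs f ≤ ∑ xs g
∑-mono-≤ []       f≤g = z≤n
∑-mono-≤ (x ∷ xs) f≤g = +-mono-≤ (f≤g x) (∑-mono-≤ xs f≤g)

∑-distrib-+ : ∀ (xs : List A) (f g : A → ℕ) → ∑[ x ← xs ] (f x + g x) ≡ ∑ xs f + ∑ xs g
∑-distrib-+ []       f g = refl
∑-distrib-+ (x ∷ xs) f g =
  trans (cong (f x + g x +_) (∑-distrib-+ xs f g)) (interchange (f x) (g x) (∑ xs f) (∑ xs g))

∑-distribˡ-* : ∀ (xs : List A) c (f : A → ℕ) → c * ∑ xs f ≡ ∑[ x ← xs ] (c * f x)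
∑-distribˡ-* []       c f = *-zeroʳ c
∑-distribˡ-* (x ∷ xs) c f = trans (*-distribˡ-+ c (f x) (∑ xs f)) (cong (c * f x +_) (∑-distribˡ-* xs c f))

∑-distribʳ-* : ∀ (xs : List A) c (f : A → ℕ) → ∑ xs f * c ≡ ∑[ x ← xs ] (f x * c)
∑-distribʳ-* xs c f = trans (*-comm (∑ xs f) c) (trans (∑-distribˡ-* xs c f) (∑-cong xs (λ x → *-comm c (f x))))

∑-const : ∀ (xs : List A) c → ∑[ _ ← xs ] c ≡ length xs * c
∑-const []       c = refl
∑-const (x ∷ xs) c = cong (c +_) (∑-const xs c)

∑-comm : ∀ (xs : List A) (ys : List B) (f : A → B → ℕ) →
         ∑[ x ← xs ] ∑[ y ← ys ] f x y ≡ ∑[ y ← ys ] ∑[ x ← xs ] f x y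
∑-comm []       ys f = sym (trans (∑-const ys 0) (*-zeroʳ (length ys)))
∑-comm (x ∷ xs) ys f =
  trans (cong (∑ ys (f x) +_) (∑-comm xs ys f)) (sym (∑-distrib-+ ys (f x) (λ y → ∑[ x ← xs ] f x y)))

∑-++ : ∀ (xs ys : List A) (f : A → ℕ) → ∑ (xs ++ ys) f ≡ ∑ xs f + ∑ ys f
∑-++ xs ys f = trans (cong sum (map-++ f xs ys)) (sum-++ (map f xs) (map f ys))

∑-map : ∀ (g : A → B) (xs : List A) (f : B → ℕ) → ∑ (map g xs) f ≡ ∑ xs (f ∘ g)
∑-map g xs f = cong sum (sym (map-∘ xs))

∈⇒≤∑ : ∀ {xs : List A} {x} (f : A → ℕ) → x ∈ xs → f x ≤ ∑ xs f
∈⇒≤∑ f (here refl) = m≤m+n _ _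
∈⇒≤∑ f (there x∈xs) = ≤-trans (∈⇒≤∑ f x∈xs) (m≤n+m _ _)

∃-≥-average : ∀ (x : A) xs (f : A → ℕ) c → length (x ∷ xs) * c ≤ ∑ (x ∷ xs) f → ∃ λ y → c ≤ f y
∃-≥-average x []        f c c≤∑ = x , +-cancelʳ-≤ 0 c (f x) c≤∑
∃-≥-average x (x′ ∷ xs) f c c≤∑ with c ≤? f x
... | yes c≤fx = x , c≤fx
... | no  c≰fx = ∃-≥-average x′ xs f c (+-cancelˡ-≤ c _ _ (≤-trans c≤∑ (+-monoˡ-≤ _ (<⇒≤ (≰⇒> c≰fx)))))

-- Averaging over the seeds r: the easy direction of Yao's principle.
∃-≥-average-seed : ∀ {N} (xs : List A) (f : Fin (suc N) → A → ℕ) c →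
                   (∀ x → c * suc N ≤ ∑[ r ← allFin (suc N) ] f r x) →
                   ∃ λ r → c * length xs ≤ ∑ xs (f r)
∃-≥-average-seed {N = N} xs f c c≤∑ = ∃-≥-average zero (tabulate suc) (λ r → ∑ xs (f r)) (c * length xs) (begin
  length (allFin (suc N)) * (c * length xs)   ≡⟨ cong (_* (c * length xs)) (length-tabulate {n = suc N} id) ⟩
  suc N * (c * length xs)                      ≡⟨ swap (suc N) c (length xs) ⟩
  length xs * (c * suc N)                      ≡⟨ sym (∑-const xs (c * suc N)) ⟩
  ∑[ x ← xs ] (c * suc N)                      ≤⟨ ∑-mono-≤ xs c≤∑ ⟩
  ∑[ x ← xs ] ∑[ r ← allFin (suc N) ] f r x    ≡⟨ ∑-comm xs (allFin (suc N)) (λ x r → f r x) ⟩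
  ∑[ r ← allFin (suc N) ] ∑ xs (f r)          ∎)
  where
  open ≤-Reasoning
  swap : ∀ N c l → N * (c * l) ≡ l * (c * N)
  swap = solve-∀

∑-allFin-suc : ∀ {n} (f : Fin (suc n) → ℕ) → ∑ (allFin (suc n)) f ≡ f zero + ∑ (allFin n) (f ∘ suc)
∑-allFin-suc {n} f = cong (f zero +_) (trans (cong (λ xs → ∑ xs f) (sym (map-tabulate id suc))) (∑-map suc (allFin n) f))

∣∣≤∑ : ∀ {n} (G : Subset n) (f : Fin n → ℕ) → (∀ r → r Subset.∈ G → 1 ≤ f r) → ∣ G ∣ ≤ ∑ (allFin n) f
∣∣≤∑ []            f 1≤f = z≤n
∣∣≤∑ (inside ∷ G)  f 1≤f rewrite ∑-allFin-suc f =
  +-mono-≤ (1≤f zero here) (∣∣≤∑ G (f ∘ suc) (λ r r∈G → 1≤f (suc r) (there r∈G)))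
∣∣≤∑ (outside ∷ G) f 1≤f rewrite ∑-allFin-suc f =
  ≤-trans (∣∣≤∑ G (f ∘ suc) (λ r r∈G → 1≤f (suc r) (there r∈G))) (m≤n+m _ _)

vectors : ∀ m → List (Vec Bool m)
vectors zero    = [ [] ]
vectors (suc m) = map (true ∷_) (vectors m) ++ map (false ∷_) (vectors m)

length-vectors : ∀ m → length (vectors m) ≡ 2 ^ m
length-vectors zero    = refl
length-vectors (suc m) = begin
  length (map (true ∷_) (vectors m) ++ map (false ∷_) (vectors m))
    ≡⟨ length-++ (map (true ∷_) (vectors m)) ⟩
  length (map (true ∷_) (vectors m)) + length (map (false ∷_) (vectors m))
    ≡⟨ cong₂ _+_ (length-map (true ∷_) (vectors m)) (length-map (false ∷_) (vectors m)) ⟩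
  length (vectors m) + length (vectors m)
    ≡⟨ cong (λ k → k + k) (length-vectors m) ⟩
  2 ^ m + 2 ^ m
    ≡⟨ cong (2 ^ m +_) (sym (+-identityʳ (2 ^ m))) ⟩
  2 ^ suc m ∎
  where open ≡-Reasoning

∑-vectors-suc : ∀ m (f : Vec Bool (suc m) → ℕ) →
                ∑ (vectors (suc m)) f ≡ ∑ (vectors m) (f ∘ (true ∷_)) + ∑ (vectors m) (f ∘ (false ∷_))
∑-vectors-suc m f = trans (∑-++ (map (true ∷_) (vectors m)) _ f)
                          (cong₂ _+_ (∑-map (true ∷_) (vectors m) f) (∑-map (false ∷_) (vectors m) f))

-- Power inequalities

^-distrib-* : ∀ m n k → (m * n) ^ k ≡ m ^ k * n ^ k
^-distrib-* m n zero    = refl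
^-distrib-* m n (suc k) = trans (cong (m * n *_) (^-distrib-* m n k)) (*-interchange m n (m ^ k) (n ^ k))

^-*-^-split : ∀ u v i j a d → u ^ (i + a) * v ^ (j + d) ≡ (u ^ i * v ^ j) * (u ^ a * v ^ d)
^-*-^-split u v i j a d = begin
  u ^ (i + a) * v ^ (j + d)         ≡⟨ cong₂ _*_ (^-distribˡ-+-* u i a) (^-distribˡ-+-* v j d) ⟩
  u ^ i * u ^ a * (v ^ j * v ^ d)   ≡⟨ *-interchange (u ^ i) (u ^ a) (v ^ j) (v ^ d) ⟩
  u ^ i * v ^ j * (u ^ a * v ^ d)   ∎
  where open ≡-Reasoning

^-*-^-mono : ∀ {u v t r α δ} → v ≤ u → t ≤ α → α + δ ≡ t + r → u ^ t * v ^ r ≤ u ^ α * v ^ δ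
^-*-^-mono {u} {v} {t} {r} {α} {δ} v≤u t≤α α+δ≡t+r with m≤n⇒∃[o]m+o≡n t≤α
... | k , refl = begin
  u ^ t * v ^ r             ≡⟨ cong (λ e → u ^ t * v ^ e) r≡k+δ ⟩
  u ^ t * v ^ (k + δ)       ≡⟨ cong (u ^ t *_) (^-distribˡ-+-* v k δ) ⟩
  u ^ t * (v ^ k * v ^ δ)   ≤⟨ *-monoʳ-≤ (u ^ t) (*-monoˡ-≤ (v ^ δ) (^-monoˡ-≤ k v≤u)) ⟩
  u ^ t * (u ^ k * v ^ δ)   ≡⟨ sym (*-assoc (u ^ t) _ _) ⟩
  u ^ t * u ^ k * v ^ δ     ≡⟨ cong (_* v ^ δ) (sym (^-distribˡ-+-* u t k)) ⟩
  u ^ (t + k) * v ^ δ       ∎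
  where
  open ≤-Reasoning
  r≡k+δ : r ≡ k + δ
  r≡k+δ = sym (+-cancelˡ-≡ t _ _ (trans (sym (+-assoc t k δ)) α+δ≡t+r))

-- Markov's inequality for the weight u ^ α * v ^ δ at the threshold α = t.
threshold-bound : ∀ {u v n} t r α δ → v ≤ u → t + r ≡ n → α + δ ≡ n →
                  α * (u ^ t * v ^ r) ≤ t * (u ^ t * v ^ r) + n * (u ^ α * v ^ δ)
threshold-bound {u} {v} {n} t r α δ v≤u t+r≡n α+δ≡n with α ≤? t
... | yes α≤t = ≤-trans (*-monoˡ-≤ _ α≤t) (m≤m+n _ _)
... | no  α≰t = ≤-trans (*-mono-≤ α≤n (^-*-^-mono v≤u (<⇒≤ (≰⇒> α≰t)) (trans α+δ≡n (sym t+r≡n))))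
                        (m≤n+m _ _)
  where
  α≤n : α ≤ n
  α≤n = ≤-trans (m≤m+n α δ) (≤-reflexive α+δ≡n)

suc-^-mean-value : ∀ c k → suc c ^ suc k ≤ suc c * c ^ k + k * suc c ^ k
suc-^-mean-value c zero    = ≤-reflexive (sym (+-identityʳ _))
suc-^-mean-value c (suc k) = begin
  suc c ^ suc (suc k)                                   ≡⟨ unfold c (suc c ^ suc k) ⟩
  c * suc c ^ suc k + suc c ^ suc k                     ≤⟨ +-monoˡ-≤ _ (*-monoʳ-≤ c (suc-^-mean-value c k)) ⟩
  c * (suc c * c ^ k + k * suc c ^ k) + suc c ^ suc k   ≤⟨ +-monoʳ-≤ (c * (suc c * c ^ k + k * suc c ^ k)) (m≤m+n _ (k * suc c ^ k)) ⟩
  c * (suc c * c ^ k + k * suc c ^ k) + (suc c * suc c ^ k + k * suc c ^ k)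
                                                        ≡⟨ regroup c k (c ^ k) (suc c ^ k) ⟩
  suc c * c ^ suc k + suc k * suc c ^ suc k             ∎
  where
  open ≤-Reasoning
  unfold : ∀ c X → suc c * X ≡ c * X + X
  unfold = solve-∀
  regroup : ∀ c k A B → c * (suc c * A + k * B) + (suc c * B + k * B) ≡ suc c * (c * A) + suc k * (suc c * B)
  regroup = solve-∀

suc-^-≤-2*^ : ∀ c S → 2 * S ≤ suc c → suc c ^ S ≤ 2 * c ^ S
suc-^-≤-2*^ c S 2S≤c+1 = *-cancelˡ-≤ (suc c) (+-cancelʳ-≤ (suc c ^ suc S) _ _ (begin
  suc c ^ suc S + suc c ^ suc S                         ≡⟨ cong (suc c ^ suc S +_) (sym (+-identityʳ _)) ⟩
  2 * suc c ^ suc S                                     ≤⟨ *-monoʳ-≤ 2 (suc-^-mean-value c S) ⟩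
  2 * (suc c * c ^ S + S * suc c ^ S)                   ≡⟨ regroup (suc c) (c ^ S) S (suc c ^ S) ⟩
  suc c * (2 * c ^ S) + 2 * S * suc c ^ S               ≤⟨ +-monoʳ-≤ _ (*-monoˡ-≤ (suc c ^ S) 2S≤c+1) ⟩
  suc c * (2 * c ^ S) + suc c ^ suc S                   ∎))
  where
  open ≤-Reasoning
  regroup : ∀ W A S B → 2 * (W * A + S * B) ≡ W * (2 * A) + 2 * S * B
  regroup = solve-∀

bernoulli : ∀ V n → V ^ n * (V + n) ≤ V * suc V ^ n
bernoulli V zero    = ≤-reflexive (trans (*-identityˡ _) (trans (+-identityʳ V) (sym (*-identityʳ V))))
bernoulli V (suc n) = begin
  V ^ suc n * (V + suc n)                         ≡⟨ expand V n (V ^ n) ⟩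
  V ^ n * (V + n) * V + V ^ n * V                 ≤⟨ m≤m+n _ (V ^ n * n) ⟩
  V ^ n * (V + n) * V + V ^ n * V + V ^ n * n     ≡⟨ collect V n (V ^ n) ⟩
  suc V * (V ^ n * (V + n))                       ≤⟨ *-monoʳ-≤ (suc V) (bernoulli V n) ⟩
  suc V * (V * suc V ^ n)                         ≡⟨ swap V (suc V ^ n) ⟩
  V * suc V ^ suc n                               ∎
  where
  open ≤-Reasoning
  expand : ∀ V n P → V * P * (V + suc n) ≡ P * (V + n) * V + P * V
  expand = solve-∀
  collect : ∀ V n P → P * (V + n) * V + P * V + P * n ≡ suc V * (P * (V + n))
  collect = solve-∀
  swap : ∀ V Q → suc V * (V * Q) ≡ V * (suc V * Q)
  swap = solve-∀

2*^-≤-suc-^ : ∀ V .{{_ : NonZero V}} → 2 * V ^ V ≤ suc V ^ V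
2*^-≤-suc-^ V = *-cancelˡ-≤ V (≤-trans (≤-reflexive (rearrange (V ^ V) V)) (bernoulli V V))
  where
  rearrange : ∀ X V → V * (2 * X) ≡ X * (V + V)
  rearrange = solve-∀

n<2^n : ∀ n → n < 2 ^ n
n<2^n zero    = s≤s z≤n
n<2^n (suc n) = ≤-trans (s≤s (n<2^n n)) (≤-trans (≤-reflexive (+-comm 1 (2 ^ n)))
                                               (+-monoʳ-≤ (2 ^ n) (≤-trans (m^n>0 2 n) (m≤m+n (2 ^ n) 0))))

2^q≤D*2^s⇒q<D+s : ∀ q D s → 2 ^ q ≤ D * 2 ^ s → q < D + s
2^q≤D*2^s⇒q<D+s q D s 2^q≤D*2^s with q <? D + s
... | yes q<D+s = q<D+s
... | no  q≮D+s = ⊥-elim (<⇒≱ (begin-strict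
  D * 2 ^ s          <⟨ *-monoˡ-< (2 ^ s) {{m^n≢0 2 s}} (n<2^n D) ⟩
  2 ^ D * 2 ^ s      ≡⟨ sym (^-distribˡ-+-* 2 D s) ⟩
  2 ^ (D + s)        ∎) (≤-trans (^-monoʳ-≤ 2 (≮⇒≥ q≮D+s)) 2^q≤D*2^s))
  where open ≤-Reasoning

-- Agreement with a string and its exponential weight

agreeAt : Bool → Bool → ℕ
agreeAt true  true  = 1
agreeAt false false = 1
agreeAt true  false = 0
agreeAt false true  = 0

agreeAt-refl : ∀ b → agreeAt b b ≡ 1
agreeAt-refl true  = refl
agreeAt-refl false = refl

agreeAt+agreeAt-not : ∀ a b → agreeAt a b + agreeAt (not a) b ≡ 1
agreeAt+agreeAt-not true  true  = refl
agreeAt+agreeAt-not true  false = refl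
agreeAt+agreeAt-not false true  = refl
agreeAt+agreeAt-not false false = refl

agree disagree : ∀ {m} → Vec Bool m → (Fin m → Bool) → ℕ
agree    []      y = 0
agree    (a ∷ x) y = agreeAt a (y zero) + agree x (y ∘ suc)
disagree []      y = 0
disagree (a ∷ x) y = agreeAt (not a) (y zero) + disagree x (y ∘ suc)

agree-∑ : ∀ {m} (x : Vec Bool m) y → agree x y ≡ ∑[ i ← allFin m ] agreeAt (lookup x i) (y i)
agree-∑ []      y = refl
agree-∑ (a ∷ x) y = trans (cong (agreeAt a (y zero) +_) (agree-∑ x (y ∘ suc)))
                          (sym (∑-allFin-suc (λ i → agreeAt (lookup (a ∷ x) i) (y i))))

agree+disagree : ∀ {m} (x : Vec Bool m) y → agree x y + disagree x y ≡ m
agree+disagree []      y = refl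
agree+disagree (a ∷ x) y =
  trans (interchange (agreeAt a (y zero)) (agree x (y ∘ suc)) (agreeAt (not a) (y zero)) (disagree x (y ∘ suc)))
        (cong₂ _+_ (agreeAt+agreeAt-not a (y zero)) (agree+disagree x (y ∘ suc)))

weight : ℕ → ℕ → ∀ {m} → Vec Bool m → (Fin m → Bool) → ℕ
weight u v x y = u ^ agree x y * v ^ disagree x y

∑-weight : ∀ u v m (y : Fin m → Bool) → ∑[ x ← vectors m ] weight u v x y ≡ (u + v) ^ m
∑-weight u v zero    y = *-identityʳ 1
∑-weight u v (suc m) y = begin
  ∑ (vectors (suc m)) (λ x → weight u v x y)
    ≡⟨ ∑-vectors-suc m (λ x → weight u v x y) ⟩
  ∑[ x ← vectors m ] weight u v (true ∷ x) y + ∑[ x ← vectors m ] weight u v (false ∷ x) y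
    ≡⟨ cong₂ _+_ (∑-cong (vectors m) (λ x → weight-∷ true x)) (∑-cong (vectors m) (λ x → weight-∷ false x)) ⟩
  ∑[ x ← vectors m ] (w true * weight u v x y′) + ∑[ x ← vectors m ] (w false * weight u v x y′)
    ≡⟨ sym (cong₂ _+_ (∑-distribˡ-* (vectors m) (w true) _) (∑-distribˡ-* (vectors m) (w false) _)) ⟩
  w true * ∑[ x ← vectors m ] weight u v x y′ + w false * ∑[ x ← vectors m ] weight u v x y′
    ≡⟨ sym (*-distribʳ-+ _ (w true) (w false)) ⟩
  (w true + w false) * ∑[ x ← vectors m ] weight u v x y′
    ≡⟨ cong₂ _*_ (w-sum (y zero)) (∑-weight u v m y′) ⟩
  (u + v) * (u + v) ^ m ∎
  where
  open ≡-Reasoning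
  y′ : Fin m → Bool
  y′ = y ∘ suc
  w : Bool → ℕ
  w a = u ^ agreeAt a (y zero) * v ^ agreeAt (not a) (y zero)
  weight-∷ : ∀ a x → weight u v (a ∷ x) y ≡ w a * weight u v x y′
  weight-∷ a x = ^-*-^-split u v (agreeAt a (y zero)) (agreeAt (not a) (y zero)) (agree x y′) (disagree x y′)
  w-sum : ∀ b → u ^ agreeAt true b * v ^ agreeAt false b + u ^ agreeAt false b * v ^ agreeAt true b ≡ u + v
  w-sum true  = cong₂ _+_ (trans (*-identityʳ (u * 1)) (*-identityʳ u)) (trans (*-identityˡ (v * 1)) (*-identityʳ v))
  w-sum false = trans (+-comm (1 * (v * 1)) (u * 1 * 1)) (w-sum true)

agreement-bound : ∀ {m K} u v t r → v ≤ u → t + r ≡ m →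
  (encode : Vec Bool m → Fin K) (decode : Fin K → Fin m → Bool) →
  ∑[ x ← vectors m ] agree x (decode (encode x)) * (u ^ t * v ^ r)
    ≤ 2 ^ m * (t * (u ^ t * v ^ r)) + m * (K * (u + v) ^ m)
agreement-bound {m} {K} u v t r v≤u t+r≡m encode decode = begin
  ∑[ x ← vectors m ] agree x (y x) * R
    ≡⟨ ∑-distribʳ-* (vectors m) R (λ x → agree x (y x)) ⟩
  ∑[ x ← vectors m ] (agree x (y x) * R)
    ≤⟨ ∑-mono-≤ (vectors m) (λ x → threshold-bound t r (agree x (y x)) (disagree x (y x)) v≤u t+r≡m (agree+disagree x (y x))) ⟩
  ∑[ x ← vectors m ] (t * R + m * weight u v x (y x))
    ≡⟨ ∑-distrib-+ (vectors m) (λ _ → t * R) (λ x → m * weight u v x (y x)) ⟩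
  ∑[ x ← vectors m ] (t * R) + ∑[ x ← vectors m ] (m * weight u v x (y x))
    ≡⟨ cong₂ _+_ (trans (∑-const (vectors m) (t * R)) (cong (_* (t * R)) (length-vectors m)))
                 (sym (∑-distribˡ-* (vectors m) m _)) ⟩
  2 ^ m * (t * R) + m * ∑[ x ← vectors m ] weight u v x (y x)
    ≤⟨ +-monoʳ-≤ (2 ^ m * (t * R)) (*-monoʳ-≤ m (∑-mono-≤ (vectors m) (λ x →
         ∈⇒≤∑ (λ j → weight u v x (decode j)) (∈-allFin (encode x))))) ⟩
  2 ^ m * (t * R) + m * ∑[ x ← vectors m ] ∑[ j ← allFin K ] weight u v x (decode j)
    ≡⟨ cong (λ s → 2 ^ m * (t * R) + m * s) (∑-comm (vectors m) (allFin K) (λ x j → weight u v x (decode j))) ⟩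
  2 ^ m * (t * R) + m * ∑[ j ← allFin K ] ∑[ x ← vectors m ] weight u v x (decode j)
    ≡⟨ cong (λ s → 2 ^ m * (t * R) + m * s) (trans (∑-cong (allFin K) (λ j → ∑-weight u v m (decode j)))
         (trans (∑-const (allFin K) ((u + v) ^ m)) (cong (_* (u + v) ^ m) (length-tabulate {n = K} id)))) ⟩
  2 ^ m * (t * R) + m * (K * (u + v) ^ m) ∎
  where
  open ≤-Reasoning
  R : ℕ
  R = u ^ t * v ^ r
  y : Vec Bool m → Fin m → Bool
  y x = decode (encode x)

-- Inputs of length L * q are cut into q blocks. V = 4 (b + 1), u = V + 1 and v = V − 1 are chosen so
-- that u * v + 1 = V * V = 2 * S; this makes T / L exceed 1/2 by so little that b T < a L.
module Blocks (b : ℕ) where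
  v V u S T L : ℕ
  v = 3 + 4 * b
  V = suc v
  u = suc V
  S = 2 * suc b * V
  T = S + V + V
  L = T + S

  v≤u : v ≤ u
  v≤u = m≤n+m v 2

  u*v+1≡V*V : suc (u * v) ≡ V * V
  u*v+1≡V*V = square v
    where square : ∀ x → suc (suc (suc x) * x) ≡ suc x * suc x
          square = solve-∀

  2*S≤u*v+1 : 2 * S ≤ suc (u * v)
  2*S≤u*v+1 = ≤-reflexive (trans (twice b) (sym u*v+1≡V*V))
    where twice : ∀ b → 2 * (2 * suc b * suc (3 + 4 * b)) ≡ suc (3 + 4 * b) * suc (3 + 4 * b)
          twice = solve-∀

  u+v≡2*V : u + v ≡ 2 * V
  u+v≡2*V = double v
    where double : ∀ x → suc (suc x) + x ≡ 2 * suc x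
          double = solve-∀

  ^T : ∀ x → x ^ T ≡ x ^ S * x ^ V * x ^ V
  ^T x = trans (^-distribˡ-+-* x (S + V) V) (cong (_* x ^ V) (^-distribˡ-+-* x S V))

  success-gap : ∀ {a} → b < 2 * a → b * T + 1 ≤ a * L
  success-gap {a} b<2a = begin
    b * T + 1                  ≡⟨ expand b S V ⟩
    b * S + (2 * b * V + 1)    ≤⟨ +-monoʳ-≤ (b * S) 2bV+1≤S ⟩
    b * S + S                  ≡⟨ +-comm (b * S) S ⟩
    suc b * S                  ≤⟨ *-monoˡ-≤ S b<2a ⟩
    2 * a * S                  ≤⟨ m≤m+n (2 * a * S) (2 * a * V) ⟩
    2 * a * S + 2 * a * V      ≡⟨ collect a S V ⟩
    a * L                      ∎
    where
    open ≤-Reasoning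
    expand : ∀ b S V → b * (S + V + V) + 1 ≡ b * S + (2 * b * V + 1)
    expand = solve-∀
    collect : ∀ a S V → 2 * a * S + 2 * a * V ≡ a * (S + V + V + S)
    collect = solve-∀
    2bV+1≤S : 2 * b * V + 1 ≤ S
    2bV+1≤S = ≤-trans (+-monoʳ-≤ (2 * b * V) (s≤s z≤n)) (≤-reflexive (split b V))
      where split : ∀ b V → 2 * b * V + 2 * V ≡ 2 * suc b * V
            split = solve-∀

  2*V^L≤u^T*v^S : 2 * V ^ L ≤ u ^ T * v ^ S
  2*V^L≤u^T*v^S = begin
    2 * V ^ L
      ≡⟨ cong (2 *_) (trans (^-distribˡ-+-* V T S) (cong (_* V ^ S) (^T V))) ⟩
    2 * (V ^ S * V ^ V * V ^ V * V ^ S)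
      ≡⟨ shuffle (V ^ S) (V ^ V) ⟩
    (V ^ S * V ^ S) * (2 * (V ^ V * V ^ V))
      ≡⟨ cong (λ w → w * (2 * (V ^ V * V ^ V))) (trans (sym (^-distrib-* V V S)) (cong (_^ S) (sym u*v+1≡V*V))) ⟩
    suc (u * v) ^ S * (2 * (V ^ V * V ^ V))
      ≤⟨ *-monoˡ-≤ _ (suc-^-≤-2*^ (u * v) S 2*S≤u*v+1) ⟩
    2 * (u * v) ^ S * (2 * (V ^ V * V ^ V))
      ≡⟨ regroup ((u * v) ^ S) (V ^ V) ⟩
    (u * v) ^ S * (2 * V ^ V * (2 * V ^ V))
      ≤⟨ *-monoʳ-≤ ((u * v) ^ S) (*-mono-≤ (2*^-≤-suc-^ V) (2*^-≤-suc-^ V)) ⟩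
    (u * v) ^ S * (u ^ V * u ^ V)
      ≡⟨ cong (_* (u ^ V * u ^ V)) (^-distrib-* u v S) ⟩
    u ^ S * v ^ S * (u ^ V * u ^ V)
      ≡⟨ unshuffle (u ^ S) (v ^ S) (u ^ V) ⟩
    u ^ S * u ^ V * u ^ V * v ^ S
      ≡⟨ cong (_* v ^ S) (sym (^T u)) ⟩
    u ^ T * v ^ S ∎
    where
    open ≤-Reasoning
    shuffle : ∀ A B → 2 * (A * B * B * A) ≡ A * A * (2 * (B * B))
    shuffle = solve-∀
    regroup : ∀ C B → 2 * C * (2 * (B * B)) ≡ C * (2 * B * (2 * B))
    regroup = solve-∀
    unshuffle : ∀ A B C → A * B * (C * C) ≡ A * C * C * B
    unshuffle = solve-∀

  2^q*V^Lq≤u^Tq*v^Sq : ∀ q → 2 ^ q * V ^ (L * q) ≤ u ^ (T * q) * v ^ (S * q)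
  2^q*V^Lq≤u^Tq*v^Sq q = begin
    2 ^ q * V ^ (L * q)           ≡⟨ cong (2 ^ q *_) (sym (^-*-assoc V L q)) ⟩
    2 ^ q * (V ^ L) ^ q           ≡⟨ sym (^-distrib-* 2 (V ^ L) q) ⟩
    (2 * V ^ L) ^ q               ≤⟨ ^-monoˡ-≤ q 2*V^L≤u^T*v^S ⟩
    (u ^ T * v ^ S) ^ q           ≡⟨ ^-distrib-* (u ^ T) (v ^ S) q ⟩
    (u ^ T) ^ q * (v ^ S) ^ q     ≡⟨ cong₂ _*_ (^-*-assoc u T q) (^-*-assoc v S q) ⟩
    u ^ (T * q) * v ^ (S * q)     ∎
    where open ≤-Reasoning

  index-lower-bound : ∀ {a} → b < 2 * a → ∀ q .{{_ : NonZero q}} {K}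
    (encode : Vec Bool (L * q) → Fin K) (decode : Fin K → Fin (L * q) → Bool) →
    a * (L * q) * 2 ^ (L * q) ≤ b * ∑[ x ← vectors (L * q) ] agree x (decode (encode x)) →
    2 ^ q ≤ b * L * K
  index-lower-bound {a} b<2a q {K} encode decode success =
    *-cancelʳ-≤ (2 ^ q) (b * L * K) U (≤-trans (2^q*V^Lq≤u^Tq*v^Sq q) R≤bLKU)
    where
    m P U R C : ℕ
    m = L * q
    P = 2 ^ m
    U = V ^ m
    R = u ^ (T * q) * v ^ (S * q)
    C = ∑[ x ← vectors m ] agree x (decode (encode x))

    instance
      P≢0 : NonZero P
      P≢0 = m^n≢0 2 m
      U≢0 : NonZero U
      U≢0 = m^n≢0 V m

    agreements : C * R ≤ P * (T * q * R) + m * (K * (P * U))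
    agreements = subst (λ w → C * R ≤ P * (T * q * R) + m * (K * w))
                       (trans (cong (_^ m) u+v≡2*V) (^-distrib-* 2 V m))
                       (agreement-bound u v (T * q) (S * q) v≤u (sym (*-distribʳ-+ q T S)) encode decode)

    R≤bLKU : R ≤ b * L * K * U
    R≤bLKU = *-cancelˡ-≤ (q * P) {{m*n≢0 q P}} (+-cancelˡ-≤ (b * T * Z) _ _ (begin
      b * T * Z + Z                                    ≡⟨ +-comm (b * T * Z) Z ⟩
      suc (b * T) * Z                                  ≡⟨ cong (_* Z) (+-comm 1 (b * T)) ⟩
      (b * T + 1) * Z                                  ≤⟨ *-monoˡ-≤ Z (success-gap {a} b<2a) ⟩
      a * L * Z                                        ≡⟨ regroup a L q P R ⟩
      a * m * P * R                                    ≤⟨ *-monoˡ-≤ R success ⟩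
      b * C * R                                        ≡⟨ *-assoc b C R ⟩
      b * (C * R)                                      ≤⟨ *-monoʳ-≤ b agreements ⟩
      b * (P * (T * q * R) + m * (K * (P * U)))        ≡⟨ expand b P T q R L K U ⟩
      b * T * Z + q * P * (b * L * K * U)              ∎))
      where
      open ≤-Reasoning
      Z : ℕ
      Z = q * P * R
      regroup : ∀ a L q P R → a * L * (q * P * R) ≡ a * (L * q) * P * R
      regroup = solve-∀
      expand : ∀ b P T q R L K U →
               b * (P * (T * q * R) + L * q * (K * (P * U))) ≡ b * T * (q * P * R) + q * P * (b * L * K * U)
      expand = solve-∀

-- The reduction from Index to Edge Dominating Set(1)

-- Vertex 0 is the hub, 1 a private neighbour of it, 2 the probe vertex, followed by e isolated
-- padding vertices and the m item vertices.
module Gadget (e m : ℕ) where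
  n : ℕ
  n = 3 + (e + m)

  item : Fin m → Fin n
  item j = suc (suc (suc (e ↑ʳ j)))

  base : Edge n
  base = (zero , suc zero) , s≤s z≤n

  spoke probe : Fin m → Edge n
  spoke j = (zero , item j) , s≤s z≤n
  probe i = (suc (suc zero) , item i) , s≤s (s≤s (s≤s z≤n))

  bit? : ∀ (x : Vec Bool m) j → Dec (lookup x j ≡ true)
  bit? x j = lookup x j ≟ᵇ true

  spokes : Vec Bool m → List (Edge n)
  spokes x = map spoke (filter (bit? x) (allFin m))

  graph : Vec Bool m → Fin m → List (Edge n)
  graph x i = (base ∷ spokes x) ++ [ probe i ]

  item-injective : ∀ {i j} → item i ≡ item j → i ≡ j
  item-injective = ↑ʳ-injective e _ _ ∘ fsuc-injective ∘ fsuc-injective ∘ fsuc-injective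

  ∈-spokes⁺ : ∀ x {j} → lookup x j ≡ true → spoke j ∈ spokes x
  ∈-spokes⁺ x {j} xj = ∈-map⁺ spoke (∈-filter⁺ (bit? x) (∈-allFin j) xj)

  ∈-spokes⁻ : ∀ x {f} → f ∈ spokes x → ∃ λ j → lookup x j ≡ true × f ≡ spoke j
  ∈-spokes⁻ x f∈ with ∈-map⁻ spoke f∈
  ... | j , j∈ , refl with ∈-filter⁻ (bit? x) {xs = allFin m} j∈
  ...   | _ , xj = j , xj , refl

  data GraphEdge (x : Vec Bool m) (i : Fin m) : Edge n → Set where
    is-base  : GraphEdge x i base
    is-spoke : ∀ {j} → lookup x j ≡ true → GraphEdge x i (spoke j)
    is-probe : GraphEdge x i (probe i)

  ∈-graph⁻ : ∀ x {i f} → f ∈ graph x i → GraphEdge x i f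
  ∈-graph⁻ x (here refl) = is-base
  ∈-graph⁻ x (there f∈) with ∈-++⁻ (spokes x) f∈
  ... | inj₁ f∈spokes with ∈-spokes⁻ x f∈spokes
  ...   | _ , xj , refl = is-spoke xj
  ∈-graph⁻ x (there f∈) | inj₂ (here refl) = is-probe

  graph-unique : ∀ x i → Unique (graph x i)
  graph-unique x i = All-tabulate base∉ ∷ Unique.++⁺ spokes-unique ([] ∷ []) spokes∌probe
    where
    spokes-unique : Unique (spokes x)
    spokes-unique = Unique.map⁺ (item-injective ∘ cong tgt) (Unique.filter⁺ (bit? x) (allFin⁺ m))
    spokes∌probe : ∀ {f} → ¬ (f ∈ spokes x × f ∈ [ probe i ])
    spokes∌probe (f∈ , here refl) with ∈-spokes⁻ x f∈
    ... | _ , _ , ()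
    base∉ : ∀ {f} → f ∈ spokes x ++ [ probe i ] → base ≢ f
    base∉ f∈ with ∈-++⁻ (spokes x) f∈
    ... | inj₁ f∈spokes with ∈-spokes⁻ x f∈spokes
    ...   | _ , _ , refl = λ ()
    base∉ f∈ | inj₂ (here refl) = λ ()

  Covers : Edge n → Edge n → Set
  Covers f g = g ≡ f ⊎ Adjacent g f

  -- base and probe i are vertex-disjoint; only spoke i touches both.
  covers-base-and-probe : ∀ {x i f} → GraphEdge x i f → Covers f base → Covers f (probe i) → lookup x i ≡ true
  covers-base-and-probe is-base _ (inj₁ ())
  covers-base-and-probe is-base _ (inj₂ (inj₁ ()))
  covers-base-and-probe is-base _ (inj₂ (inj₂ (inj₁ ())))
  covers-base-and-probe is-base _ (inj₂ (inj₂ (inj₂ (inj₁ ()))))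
  covers-base-and-probe is-base _ (inj₂ (inj₂ (inj₂ (inj₂ ()))))
  covers-base-and-probe (is-spoke _) _ (inj₁ ())
  covers-base-and-probe (is-spoke _) _ (inj₂ (inj₁ ()))
  covers-base-and-probe (is-spoke _) _ (inj₂ (inj₂ (inj₁ ())))
  covers-base-and-probe (is-spoke _) _ (inj₂ (inj₂ (inj₂ (inj₁ ()))))
  covers-base-and-probe {x} (is-spoke xj) _ (inj₂ (inj₂ (inj₂ (inj₂ items)))) =
    trans (cong (lookup x) (item-injective items)) xj
  covers-base-and-probe is-probe (inj₁ ()) _
  covers-base-and-probe is-probe (inj₂ (inj₁ ())) _
  covers-base-and-probe is-probe (inj₂ (inj₂ (inj₁ ()))) _
  covers-base-and-probe is-probe (inj₂ (inj₂ (inj₂ (inj₁ ())))) _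
  covers-base-and-probe is-probe (inj₂ (inj₂ (inj₂ (inj₂ ())))) _

  graph-hasEDS⇔ : ∀ x i → HasEDS (graph x i) 1 ⇔ lookup x i ≡ true
  graph-hasEDS⇔ x i = mk⇔ hasEDS⇒ hasEDS⇐
    where
    covered-by : ∀ {f g} → g ∈ [ f ] ⊎ Any (Adjacent g) [ f ] → Covers f g
    covered-by = Sum.map singleton⁻ singleton⁻
    hasEDS⇒ : HasEDS (graph x i) 1 → lookup x i ≡ true
    hasEDS⇒ ([] , _ , _ , _ , covered) with All-lookup covered (here refl)
    ... | inj₁ ()
    ... | inj₂ ()
    hasEDS⇒ (f ∷ [] , _ , _ , f∈ ∷ [] , covered) =
      covers-base-and-probe (∈-graph⁻ x f∈) (covered-by (All-lookup covered (here refl)))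
        (covered-by (All-lookup covered (∈-++⁺ʳ (base ∷ spokes x) (here refl))))
    hasEDS⇒ (_ ∷ _ ∷ _ , _ , s≤s () , _)
    hasEDS⇐ : lookup x i ≡ true → HasEDS (graph x i) 1
    hasEDS⇐ xi = [ spoke i ] , [] ∷ [] , s≤s z≤n , there (∈-++⁺ˡ (∈-spokes⁺ x xi)) ∷ [] , All-tabulate covered
      where
      covered : ∀ {g} → g ∈ graph x i → g ∈ [ spoke i ] ⊎ Any (Adjacent g) [ spoke i ]
      covered g∈ with ∈-graph⁻ x g∈
      ... | is-base    = inj₂ (here (inj₁ refl))
      ... | is-spoke _ = inj₂ (here (inj₁ refl))
      ... | is-probe   = inj₂ (here (inj₂ (inj₂ (inj₂ refl))))

module OneWay {a b e m s} (A : StreamAlg (3 + (e + m)) s) (solves : SolvesEDS a b A) where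
  open Gadget e m

  N : ℕ
  N = suc (seeds A)

  encode : Fin N → Vec Bool m → Fin (2 ^ s)
  encode r x = run A r 1 (base ∷ spokes x)

  decode : Fin N → Fin (2 ^ s) → Fin m → Bool
  decode r memory i = out A r 1 (step A r 1 memory (probe i))

  answer-one-way : ∀ r x i → out A r 1 (run A r 1 (graph x i)) ≡ decode r (encode r x) i
  answer-one-way r x i = cong (out A r 1) (foldl-++ (step A r 1) (init A r 1) (base ∷ spokes x) [ probe i ])

  correct-seeds : ∀ x i → a * N ≤ b * ∑[ r ← allFin N ] agreeAt (lookup x i) (decode r (encode r x) i)
  correct-seeds x i with solves 1 (graph x i) (graph-unique x i)
  ... | G , a*N≤b*∣G∣ , correct = ≤-trans a*N≤b*∣G∣ (*-monoʳ-≤ b (∣∣≤∑ G _ agrees))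
    where
    agrees : ∀ r → r Subset.∈ G → 1 ≤ agreeAt (lookup x i) (decode r (encode r x) i)
    agrees r r∈G = ≤-reflexive (sym (trans (cong (agreeAt (lookup x i)) answer≡xᵢ) (agreeAt-refl (lookup x i))))
      where
      answer≡xᵢ : decode r (encode r x) i ≡ lookup x i
      answer≡xᵢ = trans (sym (answer-one-way r x i)) (⇔→≡ (⇔.trans (correct r r∈G) (graph-hasEDS⇔ x i)))

  correct-answers : ∀ x → a * m * N ≤ ∑[ r ← allFin N ] (b * agree x (decode r (encode r x)))
  correct-answers x = begin
    a * m * N
      ≡⟨ trans (rearrange a m N) (cong (_* (a * N)) (sym (length-tabulate {n = m} id))) ⟩
    length (allFin m) * (a * N)
      ≡⟨ sym (∑-const (allFin m) (a * N)) ⟩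
    ∑[ i ← allFin m ] (a * N)
      ≤⟨ ∑-mono-≤ (allFin m) (correct-seeds x) ⟩
    ∑[ i ← allFin m ] (b * ∑[ r ← allFin N ] agreement r i)
      ≡⟨ ∑-cong (allFin m) (λ i → ∑-distribˡ-* (allFin N) b (λ r → agreement r i)) ⟩
    ∑[ i ← allFin m ] ∑[ r ← allFin N ] (b * agreement r i)
      ≡⟨ ∑-comm (allFin m) (allFin N) (λ i r → b * agreement r i) ⟩
    ∑[ r ← allFin N ] ∑[ i ← allFin m ] (b * agreement r i)
      ≡⟨ ∑-cong (allFin N) (λ r → sym (trans (cong (b *_) (agree-∑ x _)) (∑-distribˡ-* (allFin m) b (agreement r)))) ⟩
    ∑[ r ← allFin N ] (b * agree x (decode r (encode r x))) ∎
    where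
    open ≤-Reasoning
    agreement : Fin N → Fin m → ℕ
    agreement r i = agreeAt (lookup x i) (decode r (encode r x) i)
    rearrange : ∀ a m N → a * m * N ≡ m * (a * N)
    rearrange = solve-∀

  good-seed : ∃ λ r → a * m * 2 ^ m ≤ b * ∑[ x ← vectors m ] agree x (decode r (encode r x))
  good-seed with ∃-≥-average-seed (vectors m) (λ r x → b * agree x (decode r (encode r x))) (a * m) correct-answers
  ... | r , success = r , subst₂ _≤_ (cong (a * m *_) (length-vectors m))
                                     (sym (∑-distribˡ-* (vectors m) b (λ x → agree x (decode r (encode r x))))) success

eds-lower-bound : ∀ {a b} → b < 2 * a → ∀ q .{{_ : NonZero q}} e {s}
                  (A : StreamAlg (3 + (e + Blocks.L b * q)) s) → SolvesEDS a b A → q < b * Blocks.L b + s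
eds-lower-bound {a} {b} b<2a q e {s} A solves =
  let r , success = good-seed
  in  2^q≤D*2^s⇒q<D+s q (b * L) s (index-lower-bound {a} b<2a q (encode r) (decode r) success)
  where
  open Blocks b
  open OneWay {a} {b} {e} {L * q} A solves

divide : ∀ L .{{_ : NonZero L}} n → 3 ≤ n → ∃₂ λ e q → e < L × n ≡ 3 + (e + L * q)
divide L n 3≤n = k % L , k / L , m%n<n k L , (begin
  n                            ≡⟨ sym (m+[n∸m]≡n 3≤n) ⟩
  3 + k                        ≡⟨ cong (3 +_) (m≡m%n+[m/n]*n k L) ⟩
  3 + (k % L + k / L * L)      ≡⟨ cong (λ w → 3 + (k % L + w)) (*-comm (k / L) L) ⟩
  3 + (k % L + L * (k / L))    ∎)
  where
  open ≡-Reasoning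
  k : ℕ
  k = n ∸ 3

3+[e+L*q]<3+L*[1+q] : ∀ {L e} q → e < L → 3 + (e + L * q) < 3 + L * suc q
3+[e+L*q]<3+L*[1+q] {L} q e<L = +-monoʳ-≤ 3 (≤-trans (+-monoˡ-≤ (L * q) e<L) (≤-reflexive (sym (*-suc L q))))

size-bound : ∀ {L D e q} s → e < L → q < D + s → 3 + L + D * L ≤ 3 + (e + L * q) →
             3 + (e + L * q) ≤ (3 + L + D * L + L) * s
size-bound {L} {D} {e} {q} s e<L q<D+s n₀≤n =
  bound s (≤-trans (3+[e+L*q]<3+L*[1+q] q e<L) (+-monoʳ-≤ 3 (*-monoʳ-≤ L q<D+s)))
  where
  open ≤-Reasoning
  n₀ : ℕ
  n₀ = 3 + L + D * L
  bound : ∀ s → 3 + (e + L * q) < 3 + L * (D + s) → 3 + (e + L * q) ≤ (n₀ + L) * s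
  bound zero    n< = ⊥-elim (<⇒≱ (≤-trans n< (≤-trans (m≤m+n _ L) (≤-reflexive (expand L D)))) n₀≤n)
    where expand : ∀ L D → 3 + L * (D + 0) + L ≡ 3 + L + D * L
          expand = solve-∀
  bound (suc s) n< = begin
    3 + (e + L * q)              ≤⟨ <⇒≤ n< ⟩
    3 + L * (D + suc s)          ≡⟨ expand L D s ⟩
    3 + D * L + L + L * s        ≤⟨ +-mono-≤ (+-monoˡ-≤ L (+-monoˡ-≤ (D * L) (m≤m+n 3 L))) (*-monoˡ-≤ s (m≤n+m L n₀)) ⟩
    (n₀ + L) + (n₀ + L) * s      ≡⟨ sym (*-suc (n₀ + L) s) ⟩
    (n₀ + L) * suc s             ∎
    where expand : ∀ L D s → 3 + L * (D + suc s) ≡ 3 + D * L + L + L * s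
          expand = solve-∀

mainTheorem10 : ∀ (a b : ℕ) → b < 2 * a →
    ∃ λ (d : ℕ) → ∃ λ (n₀ : ℕ) → ∀ (n s : ℕ) → n₀ ≤ n →
      (A : StreamAlg n s) → SolvesEDS a b A → n ≤ d * s
mainTheorem10 a b b<2a = n₀ + L , n₀ , bound
  where
  open Blocks b using (L)
  n₀ : ℕ
  n₀ = 3 + L + b * L * L
  bound : ∀ n s → n₀ ≤ n → (A : StreamAlg n s) → SolvesEDS a b A → n ≤ (n₀ + L) * s
  bound n s n₀≤n A solves with divide L n (≤-trans (m≤m+n 3 (L + b * L * L)) n₀≤n)
  ... | e , zero  , e<L , refl = ⊥-elim (<⇒≱ (3+[e+L*q]<3+L*[1+q] 0 e<L) 3+L*1≤n)
    where 3+L*1≤n : 3 + L * 1 ≤ 3 + (e + L * 0)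
          3+L*1≤n = ≤-trans (≤-reflexive (cong (3 +_) (*-identityʳ L))) (≤-trans (m≤m+n (3 + L) (b * L * L)) n₀≤n)
  ... | e , suc q , e<L , refl = size-bound s e<L (eds-lower-bound {a} b<2a (suc q) e A solves) n₀≤n
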